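{- Let $m$ and $l$ be strictly positive integers and $\mathcal A$ a non-empty family of non-empty sets. Let $\mathbb T$ be the family of non-empty sets $\mathcal T\subseteq\mathcal A^m$. For $\mathcal T\in\mathbb T$ write $\mathcal T^*=\{\mathbf t|j:\mathbf t\in\mathcal T,\ j\le m\}\subseteq\bigcup_{j\le m}\mathcal A^j$. For $\mathcal T,\mathcal T_0\in\mathbb T$ say that $\mathcal T\preceq\mathcal T_0$ if $\mathcal T\subseteq\mathcal T_0$ and $$\mathrm{dp}(\{u:\mathbf t^\wedge u\in\mathcal T^*\})\ge\mathrm{dp}(\{u:\mathbf t^\wedge u\in\mathcal T_0^*\})/2l$$ for every $\mathbf t\in\mathcal T^*\setminus\mathcal T$. Fix $\mathcal T_0\in\mathbb T$ and a family $\langle\mathcal S_i\rangle_{i<2l}$ of sets with $\mathcal T_0\subseteq\bigcup_{i<2l}\mathcal S_i$. Then there is $\mathcal T\in\mathbb T$ with $\mathcal T\preceq\mathcal T_0$ and $\mathcal T\subseteq\mathcal S_i$ for some $i<2l$.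
   Context: For a family $\mathcal B$ of sets none of which is empty, $\mathrm{dp}(\mathcal B)=\min\{\#(I): I\cap B\ne\emptyset\text{ for all }B\in\mathcal B\}$ (so $\mathrm{dp}(\emptyset)=0$). Elements of $\mathcal A^j$ are sequences of length $j$ of members of $\mathcal A$; $\mathbf t|j$ is the restriction of the sequence $\mathbf t$ to its first $j$ terms, and $\mathbf t^\wedge u$ is the sequence $\mathbf t$ extended by one further term $u\in\mathcal A$. -}

module Defs where

open import Data.Nat using (ℕ; _*_)
open import Data.Fin using (Fin)
open import Data.List using (List; []; _∷_; _++_)
open import Data.Vec using (Vec; toList)
open import Data.Product using (Σ; ∃; _×_; _,_; proj₁; proj₂)
open import Relation.Nullary using (¬_)
open import Relation.Binary.PropositionalEquality using (_≡_)

-- Sets are modelled as predicates.  The members of the family 𝒜 are indexed by a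
-- type A, and  mem a x  says that the point x (of the ambient type X) belongs to
-- the set a ∈ 𝒜.

module _ {A : Set} {m : ℕ} where

  Star : (Vec A m → Set) → List A → Set
  Star T s = Σ (Vec A m) λ t → T t × Σ (List A) λ r → s ++ r ≡ toList t

  InT : (Vec A m → Set) → List A → Set
  InT T s = Σ (Vec A m) λ t → T t × toList t ≡ s

  Succ : (Vec A m → Set) → List A → A → Set
  Succ T s u = Star T (s ++ (u ∷ []))

-- "#P ≤ #Q" for subsets P of X and Q of Y: an injection {x | P x} → {y | Q y}
-- (injectivity measured on the underlying points, so proof-relevance is irrelevant).
Emb : {X Y : Set} → (X → Set) → (Y → Set) → Set
Emb {X} {Y} P Q =
  Σ (Σ X P → Σ Y Q) λ f →
    (p q : Σ X P) → proj₁ (f p) ≡ proj₁ (f q) → proj₁ p ≡ proj₁ q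

module _ {X A : Set} (mem : A → X → Set) where

  Transversal : (A → Set) → (X → Set) → Set
  Transversal B I = (u : A) → B u → Σ X λ x → I x × mem u x

  -- dp(C) ≤ k · dp(B):  unfolding dp as the least cardinal of a transversal,
  -- for every transversal I of B there is a transversal J of C with #J ≤ #(k × I).
  DpLe : ℕ → (A → Set) → (A → Set) → Set₁
  DpLe k B C =
    (I : X → Set) → Transversal B I →
    Σ (X → Set) λ J → Transversal C J × Emb J (λ (p : Fin k × X) → I (proj₂ p))

  Preceq : {m : ℕ} → ℕ → (Vec A m → Set) → (Vec A m → Set) → Set₁
  Preceq l T T₀ =
    ((t : Vec A _) → T t → T₀ t) ×
    ((s : List A) → Star T s → ¬ InT T s → DpLe (2 * l) (Succ T s) (Succ T₀ s))

{-# OPTIONS --safe #-}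
module Submission where

-- Colour the nodes of T₀* from the leaves up.  A leaf t gets the colours i with
-- t ∈ Sᵢ; an inner node s gets colour i if some child of s has colour i and
-- dp(children of s) ≤ 2l · dp(children of s of colour i).  Every node gets a
-- colour: its children are covered by the 2l colour classes, and the union of
-- transversals of all classes is a transversal of all children of size at most
-- 2l times the largest of them (cardinals are comparable).  Fix a colour i of the
-- root; the leaves all of whose initial segments have colour i form T ⊆ Sᵢ, and
-- every inner node of T* keeps all of its children of colour i.

open import Defs
open import Data.Bool using (Bool; false; T)
open import Data.Empty using (⊥-elim)
open import Data.Fin using (Fin; zero; suc)
open import Data.Fin.Properties using (¬∀⟶∃¬)
open import Data.List using (List; []; _∷_; _++_; [_]; length)
open import Data.List.Properties using (++-assoc; ++-identityʳ; length-++; ∷-injective)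
open import Data.Nat using (ℕ; zero; suc; _≤_; _*_; _+_)
open import Data.Nat.Properties using (+-cancelˡ-≡; suc-injective)
open import Data.Product using (Σ; ∃; _×_; _,_; proj₁; proj₂)
open import Data.Product.Properties using (,-injective)
open import Data.Sum using (_⊎_; inj₁; inj₂)
open import Data.Vec using (Vec; toList)
open import Data.Vec.Properties using (toList-injective; cast-is-id; length-toList)
open import Level using (Level)
open import Function using (_∘_)
open import Relation.Nullary using (¬_; Dec)
open import Relation.Nullary.Decidable using (isYes; fromSum; toWitness; fromWitness)
open import Relation.Binary.PropositionalEquality
  using (_≡_; refl; sym; trans; cong; subst; module ≡-Reasoning)

++-split : {A : Set} (r₁ r₂ s r : List A) → r₁ ++ r₂ ≡ s ++ r →
  (Σ (List A) λ w → r₁ ≡ s ++ w × r ≡ w ++ r₂) ⊎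
  (Σ (List A) λ w → s ≡ r₁ ++ w × r₂ ≡ w ++ r)
++-split []       r₂ s        r eq = inj₂ (s , refl , eq)
++-split (x ∷ r₁) r₂ []       r eq = inj₁ (x ∷ r₁ , refl , sym eq)
++-split (x ∷ r₁) r₂ (y ∷ s)  r eq with ∷-injective eq
... | refl , eq′ with ++-split r₁ r₂ s r eq′
...   | inj₁ (w , e₁ , e₂) = inj₁ (w , cong (x ∷_) e₁ , e₂)
...   | inj₂ (w , e₁ , e₂) = inj₂ (w , cong (x ∷_) e₁ , e₂)

completion-length : {A : Set} {m : ℕ} (s r : List A) (t : Vec A m) →
  s ++ r ≡ toList t → length s + length r ≡ m
completion-length s r t e = trans (sym (length-++ s)) (trans (cong length e) (length-toList t))

completions-equal-length : {A : Set} {m : ℕ} (s r s′ r′ : List A) (t t′ : Vec A m) →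
  length s ≡ length s′ → s ++ r ≡ toList t → s′ ++ r′ ≡ toList t′ → length r ≡ length r′
completions-equal-length {m = m} s r s′ r′ t t′ ∣s∣≡∣s′∣ e e′ =
  +-cancelˡ-≡ (length s) (length r) (length r′) (begin
    length s + length r    ≡⟨ completion-length s r t e ⟩
    m                      ≡⟨ sym (completion-length s′ r′ t′ e′) ⟩
    length s′ + length r′  ≡⟨ cong (_+ length r′) (sym ∣s∣≡∣s′∣) ⟩
    length s + length r′   ∎)
  where open ≡-Reasoning

⊆⇒Emb : {X : Set} {P Q : X → Set} → (∀ x → P x → Q x) → Emb P Q
⊆⇒Emb P⊆Q = (λ (x , p) → x , P⊆Q x p) , λ _ _ e → e

Emb-trans : {X Y Z : Set} {P : X → Set} {Q : Y → Set} {R : Z → Set} →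
  Emb P Q → Emb Q R → Emb P R
Emb-trans (f , f-inj) (g , g-inj) = g ∘ f , λ p q e → f-inj p q (g-inj (f p) (f q) e)

Emb-⋃ : {I X Y : Set} {P : I → X → Set} {Q : Y → Set} → (∀ i → Emb (P i) Q) →
  Emb (λ x → ∃ λ i → P i x) (λ (p : I × Y) → Q (proj₂ p))
Emb-⋃ {I} {X} {Y} {P} {Q} f = g , g-injective
  where
  g : Σ X (λ x → ∃ λ i → P i x) → Σ (I × Y) (Q ∘ proj₂)
  g (x , i , p) = (i , proj₁ (proj₁ (f i) (x , p))) , proj₂ (proj₁ (f i) (x , p))
  g-injective : ∀ p q → proj₁ (g p) ≡ proj₁ (g q) → proj₁ p ≡ proj₁ q
  g-injective (x , i , p) (x′ , i′ , p′) e with ,-injective e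
  ... | refl , e′ = proj₂ (f i) (x , p) (x′ , p′) e′

module _ {a r : Level} {B : Set a} (_≲_ : B → B → Set r)
         (≲-refl : ∀ {x} → x ≲ x) (≲-trans : ∀ {x y z} → x ≲ y → y ≲ z → x ≲ z)
         (≲-total : ∀ x y → x ≲ y ⊎ y ≲ x) where

  argmax : (n : ℕ) (f : Fin (suc n) → B) → Σ (Fin (suc n)) λ k → ∀ i → f i ≲ f k
  argmax zero    f = zero , λ { zero → ≲-refl }
  argmax (suc n) f with argmax n (f ∘ suc)
  ... | k , fᵢ≲fₖ with ≲-total (f zero) (f (suc k))
  ...   | inj₁ f₀≲fₖ = suc k , λ { zero → f₀≲fₖ ; (suc i) → fᵢ≲fₖ i }
  ...   | inj₂ fₖ≲f₀ = zero  , λ { zero → ≲-refl ; (suc i) → ≲-trans (fᵢ≲fₖ i) fₖ≲f₀ }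

DpLe-monoˡ : {X A : Set} (mem : A → X → Set) {k : ℕ} {B B′ C : A → Set} →
  (∀ u → B u → B′ u) → DpLe mem k B C → DpLe mem k B′ C
DpLe-monoˡ mem B⊆B′ dp I I-meets-B′ = dp I λ u b → I-meets-B′ u (B⊆B′ u b)

module Classical {X A : Set} (mem : A → X → Set)
  (lem : (P : Set) → P ⊎ ¬ P) (Emb-total : (P Q : X → Set) → Emb P Q ⊎ Emb Q P) where

  dec : (P : Set) → Dec P
  dec P = fromSum (lem P)

  ⌊_⌋ : (X → Set) → X → Bool
  ⌊ P ⌋ x = isYes (dec (P x))

  ⌊⌋-sound : (P : X → Set) → ∀ x → T (⌊ P ⌋ x) → P x
  ⌊⌋-sound P x = toWitness {a? = dec (P x)}

  ⌊⌋-complete : (P : X → Set) → ∀ x → P x → T (⌊ P ⌋ x)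
  ⌊⌋-complete P x = fromWitness {a? = dec (P x)}

  -- dp(B) > k · dp(C).  Transversals are Bool-valued so that this is a small
  -- type, to which excluded middle applies.
  DpGt : ℕ → (A → Set) → (A → Set) → Set
  DpGt k B C = Σ (X → Bool) λ χ → Transversal mem C (T ∘ χ) ×
    ((ψ : X → Bool) → Transversal mem B (T ∘ ψ) →
      ¬ Emb (T ∘ ψ) (λ (p : Fin k × X) → T (χ (proj₂ p))))

  ¬DpGt⇒DpLe : {k : ℕ} {B C : A → Set} → ¬ DpGt k B C → DpLe mem k C B
  ¬DpGt⇒DpLe {k} {B} {C} ¬gt I I-meets-C with lem (Σ (X → Bool) λ ψ →
      Transversal mem B (T ∘ ψ) × Emb (T ∘ ψ) (λ (p : Fin k × X) → T (⌊ I ⌋ (proj₂ p))))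
  ... | inj₁ (ψ , ψ-meets-B , ψ↪kI) =
    T ∘ ψ , ψ-meets-B , Emb-trans ψ↪kI (⊆⇒Emb λ (_ , x) → ⌊⌋-sound I x)
  ... | inj₂ ¬fits =
    ⊥-elim (¬gt (⌊ I ⌋ , ⌊I⌋-meets-C , λ ψ ψ-meets-B ψ↪kI → ¬fits (ψ , ψ-meets-B , ψ↪kI)))
    where
    ⌊I⌋-meets-C : Transversal mem C (T ∘ ⌊ I ⌋)
    ⌊I⌋-meets-C u c = let (x , Ix , u∋x) = I-meets-C u c in x , ⌊⌋-complete I x Ix , u∋x

  ¬DpGt⇒nonempty : {k : ℕ} {B C : A → Set} {u : A} → B u → ¬ DpGt k B C → ∃ C
  ¬DpGt⇒nonempty {k} {B} {C} {u} b ¬gt with lem (∃ C)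
  ... | inj₁ c = c
  ... | inj₂ ¬c = ⊥-elim (¬gt ((λ _ → false) , (λ u c → ⊥-elim (¬c (u , c))) , nothing-fits))
    where
    nothing-fits : (ψ : X → Bool) → Transversal mem B (T ∘ ψ) →
      ¬ Emb (T ∘ ψ) (λ (p : Fin k × X) → T false)
    nothing-fits ψ ψ-meets-B (f , _) = let (x , ψx , _) = ψ-meets-B u b in proj₂ (f (x , ψx))

  ¬all-DpGt : {n : ℕ} {B : A → Set} (C : Fin (suc n) → A → Set) →
    (∀ u → B u → ∃ λ i → C i u) → ¬ (∀ i → DpGt (suc n) B (C i))
  ¬all-DpGt {n} {B} C cover gt = no-fit ψ ψ-meets-B (Emb-trans (⊆⇒Emb (⌊⌋-sound J)) J↪χₖ)
    where
    χ : Fin (suc n) → X → Bool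
    χ i = proj₁ (gt i)
    largest : Σ (Fin (suc n)) λ k → ∀ i → Emb (T ∘ χ i) (T ∘ χ k)
    largest = argmax Emb (⊆⇒Emb λ _ p → p) Emb-trans Emb-total n (λ i → T ∘ χ i)
    k : Fin (suc n)
    k = proj₁ largest
    no-fit : (ψ : X → Bool) → Transversal mem B (T ∘ ψ) →
      ¬ Emb (T ∘ ψ) (λ (p : Fin (suc n) × X) → T (χ k (proj₂ p)))
    no-fit = proj₂ (proj₂ (gt k))
    J : X → Set
    J x = ∃ λ i → T (χ i x)
    J↪χₖ : Emb J (λ (p : Fin (suc n) × X) → T (χ k (proj₂ p)))
    J↪χₖ = Emb-⋃ (proj₂ largest)
    ψ : X → Bool
    ψ = ⌊ J ⌋
    ψ-meets-B : Transversal mem B (T ∘ ψ)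
    ψ-meets-B u b =
      let (i , c) = cover u b
          (x , χᵢx , u∋x) = proj₁ (proj₂ (gt i)) u c
      in x , ⌊⌋-complete J x (i , χᵢx) , u∋x

  dp-pigeonhole : {n : ℕ} {B : A → Set} (C : Fin (suc n) → A → Set) →
    (∀ u → B u → ∃ λ i → C i u) → ∃ λ i → ¬ DpGt (suc n) B (C i)
  dp-pigeonhole {n} C cover = ¬∀⟶∃¬ (suc n) _ (λ i → dec _) (¬all-DpGt C cover)

  module Selection (m n : ℕ) (T₀ : Vec A m → Set) (S : Fin (suc n) → Vec A m → Set)
    (cover : ∀ t → T₀ t → ∃ λ i → S i t) where

    mutual
      Good : ℕ → Fin (suc n) → List A → Set
      Good zero    i s = InT (λ t → T₀ t × S i t) s
      Good (suc k) i s = ∃ (GoodChild k i s) × ¬ DpGt (suc n) (Succ T₀ s) (GoodChild k i s)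

      GoodChild : ℕ → Fin (suc n) → List A → A → Set
      GoodChild k i s u = Succ T₀ s u × Good k i (s ++ [ u ])

    GoodBranch : Fin (suc n) → List A → List A → Set
    GoodBranch i s r = ∀ r₁ r₂ → r₁ ++ r₂ ≡ r → Good (length r₂) i (s ++ r₁)

    GoodBranch-[] : ∀ {i s} → Good 0 i s → GoodBranch i s []
    GoodBranch-[] {i} {s} g [] [] refl = subst (Good 0 i) (sym (++-identityʳ s)) g

    GoodBranch-∷ : ∀ {i s u r} → Good (suc (length r)) i s → GoodBranch i (s ++ [ u ]) r →
      GoodBranch i s (u ∷ r)
    GoodBranch-∷ {i} {s} g _ [] r₂ refl = subst (Good (length r₂) i) (sym (++-identityʳ s)) g
    GoodBranch-∷ {i} {s} {u} g br (x ∷ r₁) r₂ eq with ∷-injective eq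
    ... | refl , eq′ = subst (Good (length r₂) i) (++-assoc s [ u ] r₁) (br r₁ r₂ eq′)

    GoodBranch-graft : ∀ {i} s r r′ → length r ≡ length r′ →
      GoodBranch i [] (s ++ r) → GoodBranch i s r′ → GoodBranch i [] (s ++ r′)
    GoodBranch-graft {i} s r r′ ∣r∣≡∣r′∣ br br′ r₁ r₂ eq with ++-split r₁ r₂ s r′ eq
    ... | inj₁ (w , refl , r′≡w++r₂) = br′ w r₂ (sym r′≡w++r₂)
    ... | inj₂ (w , refl , refl) =
      subst (λ k → Good k i r₁) same-height (br r₁ (w ++ r) (sym (++-assoc r₁ w r)))
      where
      same-height : length (w ++ r) ≡ length (w ++ r′)
      same-height = trans (length-++ w) (trans (cong (length w +_) ∣r∣≡∣r′∣) (sym (length-++ w)))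

    GoodCompletion : ℕ → Fin (suc n) → List A → Set
    GoodCompletion k i s = Σ (Vec A m) λ t → T₀ t ×
      Σ (List A) λ r → s ++ r ≡ toList t × length r ≡ k × GoodBranch i s r

    good⇒completion : ∀ k {i s} → Good k i s → GoodCompletion k i s
    good⇒completion zero {s = s} g@(t , (t∈T₀ , _) , t≡s) =
      t , t∈T₀ , [] , trans (++-identityʳ s) (sym t≡s) , refl , GoodBranch-[] g
    good⇒completion (suc k) {s = s} g@((u , _ , child) , _)
      with good⇒completion k child
    ... | t , t∈T₀ , r , su++r≡t , refl , br =
      t , t∈T₀ , u ∷ r , trans (sym (++-assoc s [ u ] r)) su++r≡t , refl , GoodBranch-∷ g br

    NodeOfHeight : ℕ → List A → Set
    NodeOfHeight k s = Σ (Vec A m) λ t → T₀ t ×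
      Σ (List A) λ r → s ++ r ≡ toList t × length r ≡ k

    good-colour : ∀ k {s} → NodeOfHeight k s → ∃ λ i → Good k i s
    good-colour zero {s} (t , t∈T₀ , [] , s++[]≡t , refl) =
      let (i , t∈Sᵢ) = cover t t∈T₀
      in i , t , (t∈T₀ , t∈Sᵢ) , trans (sym s++[]≡t) (++-identityʳ s)
    good-colour (suc k) {s} (t , t∈T₀ , u₀ ∷ r , e , ∣u₀∷r∣≡1+k) =
      let (i , ¬gt) = pigeonhole in i , ¬DpGt⇒nonempty u₀-child ¬gt , ¬gt
      where
      e₀ : (s ++ [ u₀ ]) ++ r ≡ toList t
      e₀ = trans (++-assoc s [ u₀ ] r) e
      u₀-child : Succ T₀ s u₀
      u₀-child = t , t∈T₀ , r , e₀
      coloured : ∀ u → Succ T₀ s u → ∃ λ i → GoodChild k i s u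
      coloured u c@(t′ , t′∈T₀ , r′ , e′) =
        let (i , g) = good-colour k (t′ , t′∈T₀ , r′ , e′ , height) in i , c , g
        where
        height : length r′ ≡ k
        height = trans
          (completions-equal-length (s ++ [ u ]) r′ (s ++ [ u₀ ]) r t′ t
            (trans (length-++ s) (sym (length-++ s))) e′ e₀)
          (suc-injective ∣u₀∷r∣≡1+k)
      pigeonhole : ∃ λ i → ¬ DpGt (suc n) (Succ T₀ s) (GoodChild k i s)
      pigeonhole = dp-pigeonhole (λ i → GoodChild k i s) coloured

    Selected : Fin (suc n) → Vec A m → Set
    Selected i t = GoodBranch i [] (toList t)

    selected-leaf : ∀ {i t} → Selected i t → T₀ t × S i t
    selected-leaf {i} {t} sel with sel (toList t) [] (++-identityʳ (toList t))
    ... | t′ , t′∈T₀∩Sᵢ , t′≡t = subst (λ t → T₀ t × S i t) same-leaf t′∈T₀∩Sᵢ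
      where
      same-leaf : t′ ≡ t
      same-leaf = trans (sym (cast-is-id refl t′)) (toList-injective refl t′ t t′≡t)

    good-child-selected : ∀ {i t s u₀ r u} → s ++ u₀ ∷ r ≡ toList t → Selected i t →
      Good (length r) i (s ++ [ u ]) → Succ (Selected i) s u
    good-child-selected {i} {s = s} {u₀} {r} {u} e sel g with good⇒completion (length r) g
    ... | t′ , _ , r′ , e′ , ∣r′∣≡∣r∣ , br′ = t′ , subst (GoodBranch i []) e″ grafted , r′ , e′
      where
      e″ : s ++ u ∷ r′ ≡ toList t′
      e″ = trans (sym (++-assoc s [ u ] r′)) e′
      good-s : Good (suc (length r′)) i s
      good-s = subst (λ k → Good (suc k) i s) (sym ∣r′∣≡∣r∣) (sel s (u₀ ∷ r) e)
      grafted : GoodBranch i [] (s ++ u ∷ r′)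
      grafted = GoodBranch-graft s (u₀ ∷ r) (u ∷ r′) (cong suc (sym ∣r′∣≡∣r∣))
        (subst (GoodBranch i []) (sym e) sel) (GoodBranch-∷ good-s br′)

    Selected-dp : ∀ i s → Star (Selected i) s → ¬ InT (Selected i) s →
      DpLe mem (suc n) (Succ (Selected i) s) (Succ T₀ s)
    Selected-dp i s (t , sel , [] , e) s∉Selected =
      ⊥-elim (s∉Selected (t , sel , trans (sym e) (++-identityʳ s)))
    Selected-dp i s (t , sel , u₀ ∷ r , e) _ =
      let (_ , ¬gt) = sel s (u₀ ∷ r) e in
      DpLe-monoˡ mem (λ u (_ , g) → good-child-selected e sel g) (¬DpGt⇒DpLe ¬gt)

    selection-inhabited : ∃ T₀ → ∃ λ i → ∃ (Selected i)
    selection-inhabited (t₀ , t₀∈T₀)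
      with good-colour m (t₀ , t₀∈T₀ , toList t₀ , refl , length-toList t₀)
    ... | i , g with good⇒completion m g
    ...   | t , _ , r , r≡t , _ , br = i , t , subst (GoodBranch i []) r≡t br

mainTheorem2 : (X A : Set) (mem : A → X → Set) (m l : ℕ) →
    1 ≤ m → 1 ≤ l →
    A →
    ((a : A) → ∃ (mem a)) →
    ((a b : A) → ((x : X) → (mem a x → mem b x) × (mem b x → mem a x)) → a ≡ b) →
    ((P : Set) → P ⊎ ¬ P) →
    ((P Q : X → Set) → Emb P Q ⊎ Emb Q P) →
    (T₀ : Vec A m → Set) → ∃ T₀ →
    (S : Fin (2 * l) → Vec A m → Set) →
    ((t : Vec A m) → T₀ t → Σ (Fin (2 * l)) λ i → S i t) →
    Σ (Vec A m → Set) λ T →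
      ∃ T × Preceq mem l T T₀ × Σ (Fin (2 * l)) λ i → (t : Vec A m) → T t → S i t
mainTheorem2 _ _ mem m (suc l) _ _ _ _ _ lem Emb-total T₀ T₀-inhabited S cover =
  let (i , Selectedᵢ-inhabited) = selection-inhabited T₀-inhabited in
  Selected i , Selectedᵢ-inhabited ,
  ((λ t sel → proj₁ (selected-leaf sel)) , Selected-dp i) ,
  i , (λ t sel → proj₂ (selected-leaf sel))
  where
  open Classical mem lem Emb-total
  open Selection m _ T₀ S cover
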